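{- For each positive integer $k$, let $G_k$ be the graph with vertex set $[k]\cup\binom{[k]}{2}$, where $[k]=\{1,\dots,k\}$ and $\binom{[k]}{2}$ is the set of unordered pairs $\{i,j\}$ of distinct elements of $[k]$, and in which each vertex $\{i,j\}\in\binom{[k]}{2}$ is adjacent exactly to the vertices $i$ and $j$ of $[k]$ (there are no other edges). Then the number of potential maximal cliques of $G_k$ is $\Omega(4^k)$, i.e., there is a constant $c>0$ such that $G_k$ has at least $c\cdot 4^k$ potential maximal cliques for all $k\ge 1$.
   Context: Note that $[k]$ is a vertex cover of $G_k$ of size $k$ and $G_k$ has $k+\binom{k}{2}=O(k^2)$ vertices. A triangulation of a graph $G$ is a chordal graph $H$ with $V(H)=V(G)$ and $E(G)\subseteq E(H)$; it is minimal if no triangulation of $G$ has an edge set that is a proper subset of $E(H)$. A set $\Omega\subseteq V(G)$ is a potential maximal clique (PMC) of $G$ if $\Omega$ is a maximal clique of some minimal triangulation of $G$. -}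

module Defs where

open import Data.Nat using (ℕ; zero; suc; _+_; _*_; _^_; _≤_; _<_)
open import Data.Fin using (Fin; toℕ; _≟_)
import Data.Fin as Fin
open import Data.Bool using (Bool; true; false; _∨_)
open import Data.Sum using (_⊎_; inj₁; inj₂)
open import Data.Product using (Σ; _×_; _,_; ∃; ∃-syntax)
open import Data.Empty using (⊥)
open import Data.List using (List; length)
open import Data.List.Relation.Unary.All using (All)
open import Data.List.Relation.Unary.AllPairs using (AllPairs)
open import Relation.Nullary using (¬_)
open import Relation.Nullary.Decidable using (⌊_⌋)
open import Relation.Binary.PropositionalEquality using (_≡_; _≢_)

Rel : Set → Set₁
Rel V = V → V → Set

record IsSimpleGraph {V : Set} (E : Rel V) : Set where
  field
    sym   : ∀ {u v} → E u v → E v u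
    irref : ∀ {u} → ¬ E u u

VSet : Set → Set
VSet V = V → Bool

_⊆ᵥ_ : {V : Set} → VSet V → VSet V → Set
S ⊆ᵥ T = ∀ v → S v ≡ true → T v ≡ true

CycSucc : (L : ℕ) → Fin L → Fin L → Set
CycSucc L i j = (toℕ j ≡ suc (toℕ i)) ⊎ ((suc (toℕ i) ≡ L) × (toℕ j ≡ 0))

CycAdj : (L : ℕ) → Fin L → Fin L → Set
CycAdj L i j = CycSucc L i j ⊎ CycSucc L j i

IsCycle : {V : Set} → Rel V → (L : ℕ) → (Fin L → V) → Set
IsCycle E L c = (∀ i j → c i ≡ c j → i ≡ j) × (∀ i j → CycSucc L i j → E (c i) (c j))

HasChord : {V : Set} → Rel V → (L : ℕ) → (Fin L → V) → Set
HasChord E L c = ∃[ i ] ∃[ j ] (i ≢ j × ¬ CycAdj L i j × E (c i) (c j))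

Chordal : {V : Set} → Rel V → Set
Chordal {V} E = ∀ (m : ℕ) (c : Fin (4 + m) → V) → IsCycle E (4 + m) c → HasChord E (4 + m) c

_⊆ₑ_ : {V : Set} → Rel V → Rel V → Set
E ⊆ₑ F = ∀ u v → E u v → F u v

_⊊ₑ_ : {V : Set} → Rel V → Rel V → Set
E ⊊ₑ F = (E ⊆ₑ F) × (∃[ u ] ∃[ v ] (F u v × ¬ E u v))

IsTriangulation : {V : Set} → Rel V → Rel V → Set
IsTriangulation G H = IsSimpleGraph H × (G ⊆ₑ H) × Chordal H

IsMinimalTriangulation : {V : Set} → Rel V → Rel V → Set₁
IsMinimalTriangulation G H =
  IsTriangulation G H × (∀ (H' : Rel _) → IsTriangulation G H' → ¬ (H' ⊊ₑ H))

IsClique : {V : Set} → Rel V → VSet V → Set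
IsClique E Ω = ∀ u v → Ω u ≡ true → Ω v ≡ true → u ≢ v → E u v

IsMaximalClique : {V : Set} → Rel V → VSet V → Set
IsMaximalClique E Ω = IsClique E Ω × (∀ Ω' → IsClique E Ω' → Ω ⊆ᵥ Ω' → Ω' ⊆ᵥ Ω)

IsPMC : {V : Set} → Rel V → VSet V → Set₁
IsPMC G Ω = ∃[ H ] (IsMinimalTriangulation G H × IsMaximalClique H Ω)

AtLeastPMCs : {V : Set} → Rel V → ℕ → Set₁
AtLeastPMCs {V} G N =
  ∃[ Ωs ] (All (IsPMC G) Ωs
          × AllPairs (λ S T → ¬ (∀ v → S v ≡ T v)) Ωs
          × N ≤ length Ωs)

-- The graph G_k.  Vertices: [k] (encoded as Fin k) together with the
-- unordered pairs {i,j}, i ≠ j, encoded as ordered pairs (i , j) with i < j.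

Pair : ℕ → Set
Pair k = Σ (Fin k × Fin k) (λ { (i , j) → i Fin.< j })

Vk : ℕ → Set
Vk k = Fin k ⊎ Pair k

_∈ₚ_ : {k : ℕ} → Fin k → Pair k → Set
i ∈ₚ ((a , b) , _) = (i ≡ a) ⊎ (i ≡ b)

Gk : (k : ℕ) → Rel (Vk k)
Gk k (inj₁ i) (inj₁ j) = ⊥
Gk k (inj₁ i) (inj₂ p) = i ∈ₚ p
Gk k (inj₂ p) (inj₁ i) = i ∈ₚ p
Gk k (inj₂ p) (inj₂ q) = ⊥

-- Label each vertex of [k] either "separator" or with one of three colours,
-- and call a pair {a, b} crossing if a and b carry different colours.  Let Ω
-- consist of the separator S and the crossing pairs, and let H ⊇ G_k make Ω a
-- clique, S complete to [k], each colour class a clique, and join a crossing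
-- pair {a, b} also to the vertices of the colour of a (of b) of index at most
-- a (at most b).  Eliminating the non-crossing pairs, then the coloured vertices
-- by decreasing index, then Ω, is a perfect elimination ordering, so H is
-- chordal.  Leaving out any edge of H from a triangulation inside H leaves a
-- chordless cycle of length 4, 5 or 6, so H is a minimal triangulation; when
-- all three colours occur, Ω is a maximal clique of H, hence a PMC.  Fixing
-- the colours of the first three vertices, Ω determines the labels of the
-- other k - 3, which gives 4^(k-3) distinct PMCs.

module Submission where

open import Defs
open import Data.Nat using (ℕ; zero; suc; _+_; _∸_; _*_; _^_; _≤_; _<_; s≤s; z≤n)
import Data.Nat as ℕ
import Data.Nat.Properties as ℕ
open import Data.Fin using (Fin; toℕ; fromℕ; fromℕ<; inject₁; punchIn) renaming (zero to fzero; suc to fsuc)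
import Data.Fin as Fin
import Data.Fin.Properties as Fin
open import Data.Fin.Patterns using (0F; 1F; 2F; 3F)
open import Data.Sum using (_⊎_; inj₁; inj₂; [_,_]′)
import Data.Sum as Sum
open import Data.Product using (Σ; _×_; _,_; ∃-syntax; proj₁; proj₂)
open import Data.Empty using (⊥; ⊥-elim)
import Data.List as List
open import Data.List using (List; filter; cartesianProduct; allFin; map)
open import Data.List.Properties using (length-map; length-tabulate)
import Data.List.Relation.Unary.All.Properties as All
import Data.List.Relation.Unary.AllPairs as AllPairs
import Data.List.Relation.Unary.AllPairs.Properties as AllPairs
import Data.List.Relation.Unary.Unique.Propositional.Properties as Unique
open import Data.List.Relation.Unary.All as All using (All; []; _∷_)
open import Data.List.Membership.Propositional using (_∈_)
open import Data.List.Membership.Propositional.Properties using (∈-filter⁺; ∈-cartesianProduct⁺; ∈-allFin)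
open import Data.List.Extrema.Nat using (argmin; f[argmin]≤f[xs])
open import Data.Vec using (lookup) renaming ([] to []ᵥ; _∷_ to _∷ᵥ_)
open import Function using (_∘_; id)
open import Data.Bool using (Bool; true; false; if_then_else_)
open import Relation.Nullary using (¬_; Dec; yes; no; ¬?; does)
open import Relation.Nullary.Decidable.Core using (¬¬-excluded-middle)
open import Relation.Nullary.Decidable using (_×-dec_; _⊎-dec_; decidable-stable; dec-true)
open import Relation.Binary.PropositionalEquality hiding ([_])
open import Relation.Binary.Definitions using (tri<; tri≈; tri>)

-- Chordality via cycles

cycPredecessor : ∀ {n} (i : Fin (suc n)) → ∃[ h ] CycSucc (suc n) h i
cycPredecessor {n} fzero    = fromℕ n , inj₂ (cong suc (Fin.toℕ-fromℕ n) , refl)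
cycPredecessor     (fsuc i) = inject₁ i , inj₁ (cong suc (sym (Fin.toℕ-inject₁ i)))

cycSuccessor : ∀ {n} (i : Fin (suc n)) → ∃[ j ] CycSucc (suc n) i j
cycSuccessor {n} i with suc (toℕ i) ℕ.<? suc n
... | yes i+1<L = fromℕ< i+1<L , inj₁ (Fin.toℕ-fromℕ< i+1<L)
... | no  i+1≮L = fzero , inj₂ (ℕ.≤-antisym (Fin.toℕ<n i) (ℕ.≮⇒≥ i+1≮L) , refl)

-- CycSucc L i j unfolds to Step L (toℕ i) (toℕ j); on ℕ the arithmetic is done by refl patterns.
Step : ℕ → ℕ → ℕ → Set
Step L x y = y ≡ suc x ⊎ (suc x ≡ L × y ≡ 0)

module _ {m x y z : ℕ} where

  step²-≢ : Step (4 + m) x y → Step (4 + m) y z → x ≢ z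
  step²-≢ (inj₁ refl)          (inj₁ refl)          ()
  step²-≢ (inj₁ refl)          (inj₂ (refl , refl)) ()
  step²-≢ (inj₂ (refl , refl)) (inj₁ refl)          ()
  step²-≢ (inj₂ (refl , refl)) (inj₂ (() , refl))

  step²-¬step : Step (4 + m) x y → Step (4 + m) y z → ¬ Step (4 + m) x z
  step²-¬step (inj₁ refl)          (inj₁ refl)          (inj₁ ())
  step²-¬step (inj₁ refl)          (inj₁ refl)          (inj₂ (_ , ()))
  step²-¬step (inj₁ refl)          (inj₂ (refl , refl)) (inj₁ ())
  step²-¬step (inj₁ refl)          (inj₂ (refl , refl)) (inj₂ (() , _))
  step²-¬step (inj₂ (refl , refl)) (inj₁ refl)          (inj₁ ())
  step²-¬step (inj₂ (refl , refl)) (inj₁ refl)          (inj₂ (_ , ()))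
  step²-¬step (inj₂ (refl , refl)) (inj₂ (() , _))      _

  step³-impossible : Step (4 + m) x y → Step (4 + m) y z → ¬ Step (4 + m) z x
  step³-impossible (inj₁ refl)          (inj₁ refl)          (inj₁ ())
  step³-impossible (inj₁ refl)          (inj₁ refl)          (inj₂ (() , refl))
  step³-impossible (inj₁ refl)          (inj₂ (refl , refl)) (inj₁ ())
  step³-impossible (inj₁ refl)          (inj₂ (refl , refl)) (inj₂ (() , _))
  step³-impossible (inj₂ (refl , refl)) (inj₁ refl)          (inj₁ ())
  step³-impossible (inj₂ (refl , refl)) (inj₁ refl)          (inj₂ (() , _))
  step³-impossible (inj₂ (refl , refl)) (inj₂ (() , _))      _

cycNeighbours : ∀ {m} {h i j : Fin (4 + m)} → CycSucc (4 + m) h i → CycSucc (4 + m) i j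
              → h ≢ j × ¬ CycAdj (4 + m) h j
cycNeighbours hi ij =
  (λ h≡j → step²-≢ hi ij (cong toℕ h≡j)) ,
  λ { (inj₁ hj) → step²-¬step hi ij hj ; (inj₂ jh) → step³-impossible hi ij jh }

PerfectEliminationRank : {V : Set} → Rel V → (V → ℕ) → Set
PerfectEliminationRank E r =
  ∀ {u v w} → E u v → E u w → r u ≤ r v → r u ≤ r w → v ≢ w → E v w

-- The two cycle-neighbours of a vertex of least rank on the cycle form a chord.
perfectEliminationRank⇒chordal : {V : Set} {E : Rel V} {r : V → ℕ} →
  (∀ {u v} → E u v → E v u) → PerfectEliminationRank E r → Chordal E
perfectEliminationRank⇒chordal {E = E} {r} E-sym peo m c (c-injective , c-edge) =
  chordAt (argmin (r ∘ c) fzero (allFin (4 + m)))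
          (λ i → All.lookup (f[argmin]≤f[xs] {f = r ∘ c} fzero (allFin (4 + m))) (∈-allFin i))
  where
  chordAt : ∀ i₀ → (∀ i → r (c i₀) ≤ r (c i)) → HasChord E (4 + m) c
  chordAt i₀ minimal with cycPredecessor i₀ | cycSuccessor i₀
  ... | h , hi₀ | j , i₀j =
    h , j , h≢j , h≁j , peo (E-sym (c-edge h i₀ hi₀)) (c-edge i₀ j i₀j) (minimal h) (minimal j)
                            (h≢j ∘ c-injective h j)
    where
    h≢j = proj₁ (cycNeighbours hi₀ i₀j)
    h≁j = proj₂ (cycNeighbours hi₀ i₀j)

cycSucc? : ∀ L (i j : Fin L) → Dec (CycSucc L i j)
cycSucc? L i j = (toℕ j ℕ.≟ suc (toℕ i)) ⊎-dec ((suc (toℕ i) ℕ.≟ L) ×-dec (toℕ j ℕ.≟ 0))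

cycAdj? : ∀ L (i j : Fin L) → Dec (CycAdj L i j)
cycAdj? L i j = cycSucc? L i j ⊎-dec cycSucc? L j i

ChordPosition : ∀ L → Fin L × Fin L → Set
ChordPosition L (i , j) = i Fin.< j × ¬ CycAdj L i j

positionPairs : ∀ L → List (Fin L × Fin L)
positionPairs L = cartesianProduct (allFin L) (allFin L)

-- Both lists are in lexicographic order, which fixes the order of the
-- hypotheses of the concrete cycle lemmas below.
cycleEdges : ∀ L → List (Fin L × Fin L)
cycleEdges L = filter (λ p → cycSucc? L (proj₁ p) (proj₂ p)) (positionPairs L)

chordPosition? : ∀ L (p : Fin L × Fin L) → Dec (ChordPosition L p)
chordPosition? L (i , j) = (i Fin.<? j) ×-dec ¬? (cycAdj? L i j)

cycleChords : ∀ L → List (Fin L × Fin L)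
cycleChords L = filter (chordPosition? L) (positionPairs L)

∈-positionPairs : ∀ {L} (i j : Fin L) → (i , j) ∈ positionPairs L
∈-positionPairs i j = ∈-cartesianProduct⁺ (∈-allFin i) (∈-allFin j)

module _ {L : ℕ} {i j : Fin L} where

  ∈-cycleEdges : CycSucc L i j → (i , j) ∈ cycleEdges L
  ∈-cycleEdges = ∈-filter⁺ (λ p → cycSucc? L (proj₁ p) (proj₂ p)) (∈-positionPairs i j)

  ∈-cycleChords : i ≢ j → ¬ CycAdj L i j → (i , j) ∈ cycleChords L ⊎ (j , i) ∈ cycleChords L
  ∈-cycleChords i≢j i≁j with Fin.<-cmp i j
  ... | tri< i<j _ _ = inj₁ (∈-filter⁺ (chordPosition? L) (∈-positionPairs i j) (i<j , i≁j))
  ... | tri≈ _ i≡j _ = ⊥-elim (i≢j i≡j)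
  ... | tri> _ _ j<i = inj₂ (∈-filter⁺ (chordPosition? L) (∈-positionPairs j i) (j<i , i≁j ∘ Sum.swap))

module ChordlessCycles {V : Set} {E : Rel V} (E-simple : IsSimpleGraph E) (E-chordal : Chordal E) where

  open IsSimpleGraph E-simple renaming (sym to E-sym)

  chordlessCycle-impossible : ∀ {m} (c : Fin (4 + m) → V)
    → All (λ p → E (c (proj₁ p)) (c (proj₂ p))) (cycleEdges (4 + m))
    → All (λ p → ¬ E (c (proj₁ p)) (c (proj₂ p))) (cycleChords (4 + m))
    → All (λ p → c (proj₁ p) ≢ c (proj₂ p)) (cycleChords (4 + m))
    → ⊥
  chordlessCycle-impossible {m} c edges nonEdges distinct = noChord (E-chordal m c (injective , edge))
    where
    edge : ∀ i j → CycSucc (4 + m) i j → E (c i) (c j)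
    edge i j ij = All.lookup edges (∈-cycleEdges ij)

    injective : ∀ i j → c i ≡ c j → i ≡ j
    injective i j cᵢ≡cⱼ with i Fin.≟ j | cycAdj? (4 + m) i j
    ... | yes i≡j | _ = i≡j
    ... | no _ | yes (inj₁ ij) = ⊥-elim (irref (subst (E (c i)) (sym cᵢ≡cⱼ) (edge i j ij)))
    ... | no _ | yes (inj₂ ji) = ⊥-elim (irref (subst (E (c j)) cᵢ≡cⱼ (edge j i ji)))
    ... | no i≢j | no i≁j with ∈-cycleChords i≢j i≁j
    ...   | inj₁ ij = ⊥-elim (All.lookup distinct ij cᵢ≡cⱼ)
    ...   | inj₂ ji = ⊥-elim (All.lookup distinct ji (sym cᵢ≡cⱼ))

    noChord : HasChord E (4 + m) c → ⊥
    noChord (i , j , i≢j , i≁j , eᵢⱼ) with ∈-cycleChords i≢j i≁j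
    ... | inj₁ ij = All.lookup nonEdges ij eᵢⱼ
    ... | inj₂ ji = All.lookup nonEdges ji (E-sym eᵢⱼ)

  private
    separated : ∀ {x y z} → E x z → ¬ E y z → x ≢ y
    separated e ne refl = ne e

    flip≁ : ∀ {x y} → ¬ E x y → ¬ E y x
    flip≁ n = n ∘ E-sym

  cycle₄ : ∀ {a₀ a₁ a₂ a₃} → E a₀ a₁ → E a₁ a₂ → E a₂ a₃ → E a₃ a₀
         → a₀ ≢ a₂ → a₁ ≢ a₃ → ¬ E a₀ a₂ → ¬ E a₁ a₃ → ⊥
  cycle₄ {a₀} {a₁} {a₂} {a₃} e₀₁ e₁₂ e₂₃ e₃₀ d₀₂ d₁₃ n₀₂ n₁₃ =
    chordlessCycle-impossible (lookup (a₀ ∷ᵥ a₁ ∷ᵥ a₂ ∷ᵥ a₃ ∷ᵥ []ᵥ))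
      (e₀₁ ∷ e₁₂ ∷ e₂₃ ∷ e₃₀ ∷ []) (n₀₂ ∷ n₁₃ ∷ []) (d₀₂ ∷ d₁₃ ∷ [])

  -- From length five on, distinctness of the vertices follows from the non-edges.
  cycle₅ : ∀ {a₀ a₁ a₂ a₃ a₄} → E a₀ a₁ → E a₁ a₂ → E a₂ a₃ → E a₃ a₄ → E a₄ a₀
         → ¬ E a₀ a₂ → ¬ E a₀ a₃ → ¬ E a₁ a₃ → ¬ E a₁ a₄ → ¬ E a₂ a₄ → ⊥
  cycle₅ {a₀} {a₁} {a₂} {a₃} {a₄} e₀₁ e₁₂ e₂₃ e₃₄ e₄₀ n₀₂ n₀₃ n₁₃ n₁₄ n₂₄ =
    chordlessCycle-impossible (lookup (a₀ ∷ᵥ a₁ ∷ᵥ a₂ ∷ᵥ a₃ ∷ᵥ a₄ ∷ᵥ []ᵥ))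
      (e₀₁ ∷ e₁₂ ∷ e₂₃ ∷ e₃₄ ∷ e₄₀ ∷ []) (n₀₂ ∷ n₀₃ ∷ n₁₃ ∷ n₁₄ ∷ n₂₄ ∷ [])
      ( separated (E-sym e₄₀) n₂₄ ∷ separated e₀₁ (flip≁ n₁₃)
      ∷ separated (E-sym e₀₁) (flip≁ n₀₃) ∷ separated e₁₂ (flip≁ n₂₄)
      ∷ separated (E-sym e₁₂) (flip≁ n₁₄) ∷ [])

  cycle₆ : ∀ {a₀ a₁ a₂ a₃ a₄ a₅} → E a₀ a₁ → E a₁ a₂ → E a₂ a₃ → E a₃ a₄ → E a₄ a₅ → E a₅ a₀
         → ¬ E a₀ a₂ → ¬ E a₀ a₃ → ¬ E a₀ a₄ → ¬ E a₁ a₃ → ¬ E a₁ a₄ → ¬ E a₁ a₅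
         → ¬ E a₂ a₄ → ¬ E a₂ a₅ → ¬ E a₃ a₅ → ⊥
  cycle₆ {a₀} {a₁} {a₂} {a₃} {a₄} {a₅} e₀₁ e₁₂ e₂₃ e₃₄ e₄₅ e₅₀ n₀₂ n₀₃ n₀₄ n₁₃ n₁₄ n₁₅ n₂₄ n₂₅ n₃₅ =
    chordlessCycle-impossible (lookup (a₀ ∷ᵥ a₁ ∷ᵥ a₂ ∷ᵥ a₃ ∷ᵥ a₄ ∷ᵥ a₅ ∷ᵥ []ᵥ))
      (e₀₁ ∷ e₁₂ ∷ e₂₃ ∷ e₃₄ ∷ e₄₅ ∷ e₅₀ ∷ [])
      (n₀₂ ∷ n₀₃ ∷ n₀₄ ∷ n₁₃ ∷ n₁₄ ∷ n₁₅ ∷ n₂₄ ∷ n₂₅ ∷ n₃₅ ∷ [])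
      ( separated (E-sym e₅₀) n₂₅ ∷ separated e₀₁ (flip≁ n₁₃) ∷ separated e₀₁ (flip≁ n₁₄)
      ∷ separated (E-sym e₀₁) (flip≁ n₀₃) ∷ separated (E-sym e₀₁) (flip≁ n₀₄)
      ∷ separated e₁₂ (flip≁ n₂₅) ∷ separated (E-sym e₁₂) (flip≁ n₁₄)
      ∷ separated (E-sym e₁₂) (flip≁ n₁₅) ∷ separated (E-sym e₂₃) (flip≁ n₂₅) ∷ [])

-- Labels and pairs

Colour : Set
Colour = Fin 3

data Label : Set where
  sep : Label
  col : Colour → Label

sep? : ∀ a → Dec (a ≡ sep)
sep? sep     = yes refl
sep? (col _) = no λ ()

Crossing : Label → Label → Set
Crossing (col c) (col d) = c ≢ d
Crossing _       _       = ⊥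

crossing? : ∀ a b → Dec (Crossing a b)
crossing? sep     _       = no λ ()
crossing? (col c) sep     = no λ ()
crossing? (col c) (col d) = ¬? (c Fin.≟ d)

Crossing-sym : ∀ {a b} → Crossing a b → Crossing b a
Crossing-sym {col c} {col d} c≢d = c≢d ∘ sym

Crossing⇒≢ : ∀ {a b} → Crossing a b → a ≢ b
Crossing⇒≢ {col c} {col d} c≢d refl = c≢d refl

Crossing⇒≢sep : ∀ {a b} → Crossing a b → a ≢ sep
Crossing⇒≢sep {col c} {col d} _ ()

¬Crossing⇒≡ : ∀ {a b} → a ≢ sep → b ≢ sep → ¬ Crossing a b → a ≡ b
¬Crossing⇒≡ {sep}             a≢sep _     _   = ⊥-elim (a≢sep refl)
¬Crossing⇒≡ {col c} {sep}     _     b≢sep _   = ⊥-elim (b≢sep refl)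
¬Crossing⇒≡ {col c} {col d}   _     _     c≁d = cong col (decidable-stable (c Fin.≟ d) c≁d)

otherColours : ∀ c → Σ Colour λ d → Σ Colour λ e → c ≢ d × c ≢ e × d ≢ e
otherColours c = punchIn c fzero , punchIn c (fsuc fzero) ,
                 Fin.punchInᵢ≢i c fzero ∘ sym , Fin.punchInᵢ≢i c (fsuc fzero) ∘ sym ,
                 (λ ()) ∘ Fin.punchIn-injective c fzero (fsuc fzero)

noFourColours : ∀ {a b c d : Colour} → a ≢ b → a ≢ c → a ≢ d → b ≢ c → b ≢ d → c ≢ d → ⊥
noFourColours {a} {b} {c} {d} a≢b a≢c a≢d b≢c b≢d c≢d
  with Fin.pigeonhole (ℕ.n<1+n 3) (lookup (a ∷ᵥ b ∷ᵥ c ∷ᵥ d ∷ᵥ []ᵥ))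
... | i , j , i<j , same = distinct i j (Fin.<⇒≢ i<j) same
  where
  distinct : ∀ i j → i ≢ j → lookup (a ∷ᵥ b ∷ᵥ c ∷ᵥ d ∷ᵥ []ᵥ) i ≢ lookup (a ∷ᵥ b ∷ᵥ c ∷ᵥ d ∷ᵥ []ᵥ) j
  distinct 0F 0F i≢j = ⊥-elim (i≢j refl)
  distinct 0F 1F _   = a≢b
  distinct 0F 2F _   = a≢c
  distinct 0F 3F _   = a≢d
  distinct 1F 0F _   = a≢b ∘ sym
  distinct 1F 1F i≢j = ⊥-elim (i≢j refl)
  distinct 1F 2F _   = b≢c
  distinct 1F 3F _   = b≢d
  distinct 2F 0F _   = a≢c ∘ sym
  distinct 2F 1F _   = b≢c ∘ sym
  distinct 2F 2F i≢j = ⊥-elim (i≢j refl)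
  distinct 2F 3F _   = c≢d
  distinct 3F 0F _   = a≢d ∘ sym
  distinct 3F 1F _   = b≢d ∘ sym
  distinct 3F 2F _   = c≢d ∘ sym
  distinct 3F 3F i≢j = ⊥-elim (i≢j refl)

colourOf : ∀ a → a ≢ sep → ∃[ c ] a ≡ col c
colourOf sep     a≢sep = ⊥-elim (a≢sep refl)
colourOf (col c) _     = c , refl

sharedLabel : ∀ {a b a' b'} → Crossing a b → Crossing a' b' → (a ≡ a' ⊎ a ≡ b') ⊎ (b ≡ a' ⊎ b ≡ b')
sharedLabel {col c} {col d} {col c'} {col d'} c≢d c'≢d'
  with c Fin.≟ c' | c Fin.≟ d' | d Fin.≟ c' | d Fin.≟ d'
... | yes refl | _        | _        | _        = inj₁ (inj₁ refl)
... | no _     | yes refl | _        | _        = inj₁ (inj₂ refl)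
... | no _     | no _     | yes refl | _        = inj₂ (inj₁ refl)
... | no _     | no _     | no _     | yes refl = inj₂ (inj₂ refl)
... | no c≢c'  | no c≢d'  | no d≢c'  | no d≢d'  = ⊥-elim (noFourColours c≢d c≢c' c≢d' d≢c' d≢d' c'≢d')
sharedLabel {sep} ()
sharedLabel {col _} {sep} ()
sharedLabel {col _} {col _} {sep}   _ ()
sharedLabel {col _} {col _} {col _} {sep} _ ()

pattern vertex i = inj₁ i
pattern pair p   = inj₂ p

module _ {k : ℕ} where

  lo hi : Pair k → Fin k
  lo = proj₁ ∘ proj₁
  hi = proj₂ ∘ proj₁

  lo≢hi : (p : Pair k) → lo p ≢ hi p
  lo≢hi p lo≡hi = Fin.<⇒≢ (proj₂ p) lo≡hi

  pairOf : (a b : Fin k) → a ≢ b → Pair k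
  pairOf a b a≢b with Fin.<-cmp a b
  ... | tri< a<b _ _ = (a , b) , a<b
  ... | tri≈ _ a≡b _ = ⊥-elim (a≢b a≡b)
  ... | tri> _ _ b<a = (b , a) , b<a

  members : ∀ {a b x} (p : Pair k) → a ∈ₚ p → b ∈ₚ p → a ≢ b → x ∈ₚ p → x ≡ a ⊎ x ≡ b
  members p (inj₁ refl) (inj₁ refl) a≢b _   = ⊥-elim (a≢b refl)
  members p (inj₁ refl) (inj₂ refl) _   x∈p = x∈p
  members p (inj₂ refl) (inj₁ refl) _   x∈p = Sum.swap x∈p
  members p (inj₂ refl) (inj₂ refl) a≢b _   = ⊥-elim (a≢b refl)

  module _ {a b : Fin k} (a≢b : a ≢ b) where

    ∈-pairOfˡ : a ∈ₚ pairOf a b a≢b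
    ∈-pairOfˡ with Fin.<-cmp a b
    ... | tri< _ _ _   = inj₁ refl
    ... | tri≈ _ a≡b _ = ⊥-elim (a≢b a≡b)
    ... | tri> _ _ _   = inj₂ refl

    ∈-pairOfʳ : b ∈ₚ pairOf a b a≢b
    ∈-pairOfʳ with Fin.<-cmp a b
    ... | tri< _ _ _   = inj₂ refl
    ... | tri≈ _ a≡b _ = ⊥-elim (a≢b a≡b)
    ... | tri> _ _ _   = inj₁ refl

    ∉-pairOf : ∀ {x} → x ≢ a → x ≢ b → ¬ x ∈ₚ pairOf a b a≢b
    ∉-pairOf x≢a x≢b = [ x≢a , x≢b ]′ ∘ members (pairOf a b a≢b) ∈-pairOfˡ ∈-pairOfʳ a≢b

  onEndpoints : {R : Fin k → Fin k → Set} → (∀ {a b} → R a b → R b a) →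
                ∀ {a b} (p : Pair k) → a ∈ₚ p → b ∈ₚ p → a ≢ b → R a b → R (lo p) (hi p)
  onEndpoints R-sym p (inj₁ refl) (inj₁ refl) a≢b _   = ⊥-elim (a≢b refl)
  onEndpoints R-sym p (inj₁ refl) (inj₂ refl) _   Rab = Rab
  onEndpoints R-sym p (inj₂ refl) (inj₁ refl) _   Rab = R-sym Rab
  onEndpoints R-sym p (inj₂ refl) (inj₂ refl) a≢b _   = ⊥-elim (a≢b refl)

  fromEndpoints : {R : Fin k → Fin k → Set} → (∀ {a b} → R a b → R b a) →
                  ∀ {a b} (p : Pair k) → a ∈ₚ p → b ∈ₚ p → a ≢ b → R (lo p) (hi p) → R a b
  fromEndpoints R-sym p (inj₁ refl) (inj₁ refl) a≢b _   = ⊥-elim (a≢b refl)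
  fromEndpoints R-sym p (inj₁ refl) (inj₂ refl) _   Rlh = Rlh
  fromEndpoints R-sym p (inj₂ refl) (inj₁ refl) _   Rlh = R-sym Rlh
  fromEndpoints R-sym p (inj₂ refl) (inj₂ refl) a≢b _   = ⊥-elim (a≢b refl)

-- The triangulation H and the clique Ω of a labelling

module Construction {k : ℕ} (f : Fin k → Label) where

  V : Set
  V = Vk k

  Sep : Fin k → Set
  Sep x = f x ≡ sep

  infix 4 _≼_
  _≼_ : Fin k → Fin k → Set
  x ≼ a = f x ≡ f a × x Fin.≤ a

  CrossingPair : Pair k → Set
  CrossingPair p = Crossing (f (lo p)) (f (hi p))

  Fill : Fin k → Pair k → Set
  Fill x p = Sep x ⊎ x ≼ lo p ⊎ x ≼ hi p

  Joined : Fin k → Pair k → Set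
  Joined x p = x ∈ₚ p ⊎ (CrossingPair p × Fill x p)

  H : Rel V
  H (vertex x) (vertex y) = x ≢ y × ¬ Crossing (f x) (f y)
  H (vertex x) (pair p)   = Joined x p
  H (pair p)   (vertex x) = Joined x p
  H (pair p)   (pair q)   = p ≢ q × CrossingPair p × CrossingPair q

  InΩ : V → Set
  InΩ (vertex x) = Sep x
  InΩ (pair p)   = CrossingPair p

  inΩ? : ∀ v → Dec (InΩ v)
  inΩ? (vertex x) = sep? (f x)
  inΩ? (pair p)   = crossing? (f (lo p)) (f (hi p))

  Ω : VSet V
  Ω v = does (inΩ? v)

  H-sym : ∀ {u v} → H u v → H v u
  H-sym {vertex x} {vertex y} (x≢y , x≁y) = x≢y ∘ sym , x≁y ∘ Crossing-sym
  H-sym {vertex x} {pair p}   x~p         = x~p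
  H-sym {pair p}   {vertex x} x~p         = x~p
  H-sym {pair p}   {pair q}   (p≢q , ×p , ×q) = p≢q ∘ sym , ×q , ×p

  H-simple : IsSimpleGraph H
  H-simple = record { sym = λ {u} {v} → H-sym {u} {v} ; irref = irrefl }
    where
    irrefl : ∀ {u} → ¬ H u u
    irrefl {vertex x} (x≢x , _) = x≢x refl
    irrefl {pair p}   (p≢p , _) = p≢p refl

  Gk⊆H : Gk k ⊆ₑ H
  Gk⊆H (vertex x) (pair p)   x∈p = inj₁ x∈p
  Gk⊆H (pair p)   (vertex x) x∈p = inj₁ x∈p

  Ω-clique : ∀ {v w} → InΩ v → InΩ w → v ≢ w → H v w
  Ω-clique {vertex x} {vertex y} x-sep _     v≢w = v≢w ∘ cong vertex , λ x×y → Crossing⇒≢sep x×y x-sep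
  Ω-clique {vertex x} {pair q}   x-sep ×q    _   = inj₂ (×q , inj₁ x-sep)
  Ω-clique {pair p}   {vertex y} ×p    y-sep _   = inj₂ (×p , inj₁ y-sep)
  Ω-clique {pair p}   {pair q}   ×p    ×q    v≢w = v≢w ∘ cong pair , ×p , ×q

  ≼-trans : ∀ {x y z} → x ≼ y → y ≼ z → x ≼ z
  ≼-trans (fx≡fy , x≤y) (fy≡fz , y≤z) = trans fx≡fy fy≡fz , Fin.≤-trans x≤y y≤z

  common≼ : ∀ {a b} → f a ≡ f b → ∃[ w ] w ≼ a × w ≼ b
  common≼ {a} {b} fa≡fb with Fin.≤-total a b
  ... | inj₁ a≤b = a , (refl , Fin.≤-refl) , (fa≡fb , a≤b)
  ... | inj₂ b≤a = b , (sym fa≡fb , b≤a) , (refl , Fin.≤-refl)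

  fill-member : ∀ {x a} p → a ∈ₚ p → x ≼ a → Fill x p
  fill-member p (inj₁ refl) x≼a = inj₂ (inj₁ x≼a)
  fill-member p (inj₂ refl) x≼a = inj₂ (inj₂ x≼a)

  joined-≼ : ∀ {x y} p → ¬ Sep x → Joined x p → y ≼ x → Fill y p
  joined-≼ p _     (inj₁ x∈p)                    y≼x = fill-member p x∈p y≼x
  joined-≼ p x-col (inj₂ (_ , inj₁ x-sep))        _   = ⊥-elim (x-col x-sep)
  joined-≼ p _     (inj₂ (_ , inj₂ (inj₁ x≼lo))) y≼x = inj₂ (inj₁ (≼-trans y≼x x≼lo))
  joined-≼ p _     (inj₂ (_ , inj₂ (inj₂ x≼hi))) y≼x = inj₂ (inj₂ (≼-trans y≼x x≼hi))

  crossing⇒≢ : ∀ {x y} → Crossing (f x) (f y) → x ≢ y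
  crossing⇒≢ x×y = Crossing⇒≢ x×y ∘ cong f

  vertex≢ : ∀ {x y} → x ≢ y → _≢_ {A = V} (vertex x) (vertex y)
  vertex≢ x≢y refl = x≢y refl

  pair≢ : ∀ {p q} → CrossingPair p → ¬ CrossingPair q → _≢_ {A = V} (pair p) (pair q)
  pair≢ ×p ¬×q refl = ¬×q ×p

  crossingPair-intro : ∀ {a b} p → a ∈ₚ p → b ∈ₚ p → Crossing (f a) (f b) → CrossingPair p
  crossingPair-intro p a∈p b∈p a×b =
    onEndpoints (λ {a} {b} → Crossing-sym {f a} {f b}) p a∈p b∈p (crossing⇒≢ a×b) a×b

  crossingPair-elim : ∀ {a b} p → a ∈ₚ p → b ∈ₚ p → a ≢ b → CrossingPair p → Crossing (f a) (f b)
  crossingPair-elim = fromEndpoints (λ {a} {b} → Crossing-sym {f a} {f b})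

  ¬crossing-sep : ∀ {s} p → Sep s → s ∈ₚ p → ¬ CrossingPair p
  ¬crossing-sep p s-sep (inj₁ refl) ×p = Crossing⇒≢sep ×p s-sep
  ¬crossing-sep p s-sep (inj₂ refl) ×p = Crossing⇒≢sep (Crossing-sym ×p) s-sep

  ¬crossing-sameColour : ∀ {a b} p → a ∈ₚ p → b ∈ₚ p → a ≢ b → f a ≡ f b → ¬ CrossingPair p
  ¬crossing-sameColour p a∈p b∈p a≢b fa≡fb ×p = Crossing⇒≢ (crossingPair-elim p a∈p b∈p a≢b ×p) fa≡fb

  Apart : Fin k → Fin k → Set
  Apart x a = x ≢ a × ¬ x ≼ a

  crossing⇒apart : ∀ {x a} → Crossing (f x) (f a) → Apart x a
  crossing⇒apart x×a = crossing⇒≢ x×a , Crossing⇒≢ x×a ∘ proj₁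

  above⇒apart : ∀ {x a} → a Fin.< x → Apart x a
  above⇒apart a<x = Fin.<⇒≢ a<x ∘ sym , ℕ.<⇒≱ a<x ∘ proj₂

  ¬H-crossing : ∀ {x y} → Crossing (f x) (f y) → ¬ H (vertex x) (vertex y)
  ¬H-crossing x×y (_ , x≁y) = x≁y x×y

  ¬H-pairˡ : ∀ {p q} → ¬ CrossingPair p → ¬ H (pair p) (pair q)
  ¬H-pairˡ ¬×p (_ , ×p , _) = ¬×p ×p

  ¬H-pairʳ : ∀ {p q} → ¬ CrossingPair q → ¬ H (pair p) (pair q)
  ¬H-pairʳ ¬×q (_ , _ , ×q) = ¬×q ×q

  ¬H-outside : ∀ {x} p → ¬ x ∈ₚ p → ¬ CrossingPair p → ¬ H (vertex x) (pair p)
  ¬H-outside p x∉p _   (inj₁ x∈p)     = x∉p x∈p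
  ¬H-outside p _   ¬×p (inj₂ (×p , _)) = ¬×p ×p

  ¬H-apart : ∀ {x a b} p → a ∈ₚ p → b ∈ₚ p → a ≢ b → ¬ Sep x → Apart x a → Apart x b → ¬ H (vertex x) (pair p)
  ¬H-apart {x} {a} {b} p a∈p b∈p a≢b x-col (x≢a , x⋠a) (x≢b , x⋠b) = λ
    { (inj₁ x∈p)                   → [ x≢a , x≢b ]′ (members p a∈p b∈p a≢b x∈p)
    ; (inj₂ (_ , inj₁ x-sep))       → x-col x-sep
    ; (inj₂ (_ , inj₂ (inj₁ x≼lo))) → not-below (inj₁ refl) x≼lo
    ; (inj₂ (_ , inj₂ (inj₂ x≼hi))) → not-below (inj₂ refl) x≼hi }
    where
    not-below : ∀ {c} → c ∈ₚ p → ¬ x ≼ c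
    not-below c∈p x≼c =
      [ (λ c≡a → x⋠a (subst (x ≼_) c≡a x≼c)) , (λ c≡b → x⋠b (subst (x ≼_) c≡b x≼c)) ]′
      (members p a∈p b∈p a≢b c∈p)

  top : ℕ
  top = suc (suc k)

  base : V → ℕ
  base (vertex x) = suc (k ∸ toℕ x)
  base (pair p)   = 0

  rank : V → ℕ
  rank v = if Ω v then top else base v

  base<top : ∀ v → base v < top
  base<top (vertex x) = s≤s (s≤s (ℕ.m∸n≤m k (toℕ x)))
  base<top (pair p)   = s≤s z≤n

  top≤rank⇒InΩ : ∀ v → top ≤ rank v → InΩ v
  top≤rank⇒InΩ v top≤rank with inΩ? v
  ... | yes v∈Ω = v∈Ω
  ... | no  _   = ⊥-elim (ℕ.<⇒≱ (base<top v) top≤rank)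

  data LaterNeighbour (x : Fin k) : V → Set where
    inΩ      : ∀ {v} → InΩ v → H (vertex x) v → LaterNeighbour x v
    ≼-before : ∀ {y} → y ≼ x → y ≢ x → LaterNeighbour x (vertex y)

  laterNeighbour : ∀ {x v} → ¬ Sep x → H (vertex x) v → base (vertex x) ≤ rank v → LaterNeighbour x v
  laterNeighbour {x} {v} x-col x~v rx≤rv with inΩ? v
  ... | yes v∈Ω = inΩ v∈Ω x~v
  laterNeighbour {x} {vertex y} x-col (x≢y , x≁y) rx≤ry | no y-col =
    ≼-before (sym (¬Crossing⇒≡ x-col y-col x≁y) ,
              ℕ.∸-cancelʳ-≤ (ℕ.<⇒≤ (Fin.toℕ<n y)) (ℕ.s≤s⁻¹ rx≤ry))
             (x≢y ∘ sym)
  laterNeighbour {x} {pair p} _ _ () | no _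

  Ω-≼-adjacent : ∀ {x y v} → ¬ Sep x → InΩ v → H (vertex x) v → y ≼ x → v ≢ vertex y → H v (vertex y)
  Ω-≼-adjacent {v = vertex s} _     s-sep _   _   v≢y = v≢y ∘ cong vertex , λ s×y → Crossing⇒≢sep s×y s-sep
  Ω-≼-adjacent {v = pair p}   x-col ×p    x~p y≼x _   = inj₂ (×p , joined-≼ p x-col x~p y≼x)

  laterNeighbours-adjacent : ∀ {x v w} → ¬ Sep x → LaterNeighbour x v → LaterNeighbour x w → v ≢ w → H v w
  laterNeighbours-adjacent _     (inΩ v∈Ω _)   (inΩ w∈Ω _)    v≢w = Ω-clique v∈Ω w∈Ω v≢w
  laterNeighbours-adjacent x-col (inΩ v∈Ω x~v) (≼-before y≼x _) v≢w = Ω-≼-adjacent x-col v∈Ω x~v y≼x v≢w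
  laterNeighbours-adjacent x-col (≼-before y≼x _) (inΩ w∈Ω x~w) v≢w =
    H-sym (Ω-≼-adjacent x-col w∈Ω x~w y≼x (v≢w ∘ sym))
  laterNeighbours-adjacent _ (≼-before (fy≡fx , _) _) (≼-before (fz≡fx , _) _) v≢w =
    v≢w ∘ cong vertex , λ y×z → Crossing⇒≢ y×z (trans fy≡fx (sym fz≡fx))

  -- A non-crossing pair is adjacent only to its two members.
  nonCrossing-neighbours-adjacent : ∀ {p v w} → ¬ CrossingPair p → H (pair p) v → H (pair p) w → v ≢ w → H v w
  nonCrossing-neighbours-adjacent {p} {vertex a} {vertex b} ¬×p (inj₁ a∈p) (inj₁ b∈p) v≢w =
    v≢w ∘ cong vertex , λ a×b → ¬×p (crossingPair-intro p a∈p b∈p a×b)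
  nonCrossing-neighbours-adjacent {v = vertex _} ¬×p (inj₂ (×p , _)) _ _ = ⊥-elim (¬×p ×p)
  nonCrossing-neighbours-adjacent {w = vertex _} ¬×p _ (inj₂ (×p , _)) _ = ⊥-elim (¬×p ×p)
  nonCrossing-neighbours-adjacent {v = pair _} ¬×p (_ , ×p , _) _ _ = ⊥-elim (¬×p ×p)
  nonCrossing-neighbours-adjacent {w = pair _} ¬×p _ (_ , ×p , _) _ = ⊥-elim (¬×p ×p)

  H-perfectEliminationRank : PerfectEliminationRank H rank
  H-perfectEliminationRank {u} {v} {w} u~v u~w ru≤rv ru≤rw v≢w with inΩ? u
  ... | yes _ = Ω-clique (top≤rank⇒InΩ v ru≤rv) (top≤rank⇒InΩ w ru≤rw) v≢w
  H-perfectEliminationRank {vertex x} u~v u~w ru≤rv ru≤rw v≢w | no x-col =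
    laterNeighbours-adjacent x-col (laterNeighbour x-col u~v ru≤rv) (laterNeighbour x-col u~w ru≤rw) v≢w
  H-perfectEliminationRank {pair p} u~v u~w _ _ v≢w | no ¬×p =
    nonCrossing-neighbours-adjacent ¬×p u~v u~w v≢w

  H-chordal : Chordal H
  H-chordal = perfectEliminationRank⇒chordal (λ {u} {v} → H-sym {u} {v}) H-perfectEliminationRank

  module AllColours (rep : Colour → Fin k) (rep-col : ∀ c → f (rep c) ≡ col c) where

    reps-crossing : ∀ {c d} → c ≢ d → Crossing (f (rep c)) (f (rep d))
    reps-crossing {c} {d} = subst₂ Crossing (sym (rep-col c)) (sym (rep-col d))

    otherColour : ∀ {x} → ¬ Sep x → ∃[ y ] Crossing (f x) (f y)
    otherColour {x} x-col with colourOf (f x) x-col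
    ... | c , fx≡c with otherColours c
    ...   | d , _ , c≢d , _ = rep d , subst₂ Crossing (sym fx≡c) (sym (rep-col d)) c≢d

    outsider : ∀ v → ¬ InΩ v → ∃[ w ] InΩ w × w ≢ v × ¬ H w v
    outsider (vertex x) x-col with colourOf (f x) x-col
    ... | c , fx≡c with otherColours c
    ...   | d , e , c≢d , c≢e , d≢e =
      pair de , crossingPair-intro de (∈-pairOfˡ rd≢re) (∈-pairOfʳ rd≢re) (reps-crossing d≢e) , (λ ()) ,
      ¬H-apart de (∈-pairOfˡ rd≢re) (∈-pairOfʳ rd≢re) rd≢re x-col
               (crossing⇒apart (x× c≢d)) (crossing⇒apart (x× c≢e))
      where
      rd≢re : rep d ≢ rep e
      rd≢re = crossing⇒≢ (reps-crossing d≢e)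
      de = pairOf (rep d) (rep e) rd≢re
      x× : ∀ {c'} → c ≢ c' → Crossing (f x) (f (rep c'))
      x× {c'} = subst₂ Crossing (sym fx≡c) (sym (rep-col c'))
    outsider (pair p) ¬×p =
      pair q , ×q , pair≢ ×q ¬×p , ¬H-pairʳ ¬×p
      where
      r₀≢r₁ : rep 0F ≢ rep 1F
      r₀≢r₁ = crossing⇒≢ (reps-crossing (λ ()))
      q = pairOf (rep 0F) (rep 1F) r₀≢r₁
      ×q = crossingPair-intro q (∈-pairOfˡ r₀≢r₁) (∈-pairOfʳ r₀≢r₁) (reps-crossing (λ ()))

    Ω-maximalClique : IsMaximalClique H Ω
    Ω-maximalClique = (λ u v ωu ωv → Ω-clique (Ω-sound u ωu) (Ω-sound v ωv)) , maximal
      where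
      Ω-sound : ∀ v → Ω v ≡ true → InΩ v
      Ω-sound v ωv with inΩ? v
      ... | yes v∈Ω = v∈Ω
      Ω-sound v () | no _

      maximal : ∀ Ω' → IsClique H Ω' → Ω ⊆ᵥ Ω' → Ω' ⊆ᵥ Ω
      maximal Ω' clique Ω⊆Ω' v ω'v = dec-true (inΩ? v) (decidable-stable (inΩ? v) λ v∉Ω →
        let (w , w∈Ω , w≢v , w≁v) = outsider v v∉Ω
        in w≁v (clique w v (Ω⊆Ω' w (dec-true (inΩ? w) w∈Ω)) ω'v w≢v))

    -- An edge of H missing from E would lie on a cycle of length 4, 5 or 6 whose
    -- other chords are excluded by E ⊆ H or by the previous lemmas.
    module Forced {E : Rel V} (E-simple : IsSimpleGraph E) (E-chordal : Chordal E)
                  (G⊆E : Gk k ⊆ₑ E) (E⊆H : E ⊆ₑ H) where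

      open IsSimpleGraph E-simple renaming (sym to E-sym)
      open ChordlessCycles E-simple E-chordal

      absent : ∀ {u v} → ¬ H u v → ¬ E u v
      absent ¬u~v u–v = ¬u~v (E⊆H _ _ u–v)

      member-edge : ∀ {x} p → x ∈ₚ p → E (vertex x) (pair p)
      member-edge {x} p = G⊆E (vertex x) (pair p)

      member-edge′ : ∀ {x} p → x ∈ₚ p → E (pair p) (vertex x)
      member-edge′ {x} p = G⊆E (pair p) (vertex x)

      flip¬¬ : ∀ {u v} → ¬ ¬ E u v → ¬ ¬ E v u
      flip¬¬ ¬¬u–v ¬v–u = ¬¬u–v (¬v–u ∘ E-sym)

      sep-coloured : ∀ {s} x y → Sep s → Crossing (f x) (f y) → ¬ ¬ E (vertex s) (vertex x)
      sep-coloured {s} x y s-sep x×y ¬s–x =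
        ¬¬-excluded-middle {A = E (vertex s) (pair xy)} λ
          { (yes s–xy) → cycle₄ s–sx sx–x x–xy (E-sym s–xy)
                           (vertex≢ s≢x) (pair≢ ×xy ¬×sx ∘ sym) ¬s–x (absent (¬H-pairˡ ¬×sx))
          ; (no s≁xy) → ¬¬-excluded-middle {A = E (vertex s) (vertex y)} λ
              { (yes s–y) → cycle₅ s–sx sx–x x–xy xy–y (E-sym s–y)
                              ¬s–x s≁xy (absent (¬H-pairˡ ¬×sx)) (absent (¬H-outside sx y∉sx ¬×sx))
                              (absent (¬H-crossing x×y))
              ; (no s≁y) → cycle₆ s–sx sx–x x–xy xy–y y–sy sy–s
                             ¬s–x s≁xy s≁y (absent (¬H-pairˡ ¬×sx)) (absent (¬H-outside sx y∉sx ¬×sx))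
                             (absent (¬H-pairˡ ¬×sx)) (absent (¬H-crossing x×y))
                             (absent (¬H-outside sy x∉sy ¬×sy)) (absent (¬H-pairʳ ¬×sy)) } }
        where
        x-col : ¬ Sep x
        x-col = Crossing⇒≢sep x×y
        y-col : ¬ Sep y
        y-col = Crossing⇒≢sep (Crossing-sym x×y)
        s≢x : s ≢ x
        s≢x refl = x-col s-sep
        s≢y : s ≢ y
        s≢y refl = y-col s-sep
        x≢y : x ≢ y
        x≢y = crossing⇒≢ x×y
        sx = pairOf s x s≢x
        sy = pairOf s y s≢y
        xy = pairOf x y x≢y
        ¬×sx : ¬ CrossingPair sx
        ¬×sx = ¬crossing-sep sx s-sep (∈-pairOfˡ s≢x)
        ¬×sy : ¬ CrossingPair sy
        ¬×sy = ¬crossing-sep sy s-sep (∈-pairOfˡ s≢y)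
        ×xy : CrossingPair xy
        ×xy = crossingPair-intro xy (∈-pairOfˡ x≢y) (∈-pairOfʳ x≢y) x×y
        y∉sx : ¬ y ∈ₚ sx
        y∉sx = ∉-pairOf s≢x (s≢y ∘ sym) (x≢y ∘ sym)
        x∉sy : ¬ x ∈ₚ sy
        x∉sy = ∉-pairOf s≢y (s≢x ∘ sym) x≢y
        s–sx = member-edge sx (∈-pairOfˡ s≢x)
        sx–x = member-edge′ sx (∈-pairOfʳ s≢x)
        x–xy = member-edge xy (∈-pairOfˡ x≢y)
        xy–y = member-edge′ xy (∈-pairOfʳ x≢y)
        y–sy = member-edge sy (∈-pairOfʳ s≢y)
        sy–s = member-edge′ sy (∈-pairOfˡ s≢y)

      sep-sep : ∀ {s t} → Sep s → Sep t → s ≢ t → ¬ ¬ E (vertex s) (vertex t)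
      sep-sep {s} {t} s-sep t-sep s≢t ¬s–t =
        sep-coloured q₀ q₁ s-sep q₀×q₁ λ s–q₀ → sep-coloured q₀ q₁ t-sep q₀×q₁ λ t–q₀ →
        sep-coloured q₁ q₀ t-sep q₁×q₀ λ t–q₁ → sep-coloured q₁ q₀ s-sep q₁×q₀ λ s–q₁ →
        cycle₄ s–q₀ (E-sym t–q₀) t–q₁ (E-sym s–q₁)
               (vertex≢ s≢t) (vertex≢ (crossing⇒≢ q₀×q₁)) ¬s–t (absent (¬H-crossing q₀×q₁))
        where
        q₀ = rep 0F
        q₁ = rep 1F
        q₀×q₁ : Crossing (f q₀) (f q₁)
        q₀×q₁ = reps-crossing (λ ())
        q₁×q₀ : Crossing (f q₁) (f q₀)
        q₁×q₀ = Crossing-sym q₀×q₁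

      sep-crossing : ∀ {s} p → Sep s → CrossingPair p → ¬ ¬ E (vertex s) (pair p)
      sep-crossing p s-sep ×p ¬s–p =
        sep-coloured (lo p) (hi p) s-sep ×p λ s–lo → sep-coloured (hi p) (lo p) s-sep (Crossing-sym ×p) λ s–hi →
        cycle₄ s–lo (member-edge p (inj₁ refl)) (member-edge′ p (inj₂ refl)) (E-sym s–hi)
               (λ ()) (vertex≢ (lo≢hi p)) ¬s–p (absent (¬H-crossing ×p))

      strictlyBelow-member : ∀ {x y z} p → y ∈ₚ p → z ∈ₚ p → f x ≡ f y → x Fin.< y → Crossing (f y) (f z)
                           → ¬ ¬ E (vertex x) (pair p)
      strictlyBelow-member {x} {y} {z} p y∈p z∈p fx≡fy x<y y×z ¬x–p =
        ¬¬-excluded-middle {A = E (pair p) (pair xz)} λ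
          { (yes p–xz) → ¬¬-excluded-middle {A = E (vertex x) (vertex y)} λ
              { (yes x–y) → cycle₄ x–y y–p p–xz xz–x (λ ()) (λ ()) ¬x–p y≁xz
              ; (no x≁y)  → cycle₅ x–xy xy–y y–p p–xz xz–x
                              x≁y ¬x–p (absent (¬H-pairˡ ¬×xy)) (absent (¬H-pairˡ ¬×xy)) y≁xz }
          ; (no p≁xz) → ¬¬-excluded-middle {A = E (vertex x) (vertex y)} λ
              { (yes x–y) → cycle₅ x–y y–p p–z z–xz xz–x
                              ¬x–p x≁z y≁z y≁xz p≁xz
              ; (no x≁y)  → cycle₆ x–xy xy–y y–p p–z z–xz xz–x
                              x≁y ¬x–p x≁z (absent (¬H-pairˡ ¬×xy)) (absent (¬H-outside xy z∉xy ¬×xy))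
                              (absent (¬H-pairˡ ¬×xy)) y≁z y≁xz p≁xz } }
        where
        x×z : Crossing (f x) (f z)
        x×z = subst (λ a → Crossing a (f z)) (sym fx≡fy) y×z
        x≢y : x ≢ y
        x≢y = Fin.<⇒≢ x<y
        x≢z : x ≢ z
        x≢z = crossing⇒≢ x×z
        y≢z : y ≢ z
        y≢z = crossing⇒≢ y×z
        xy = pairOf x y x≢y
        xz = pairOf x z x≢z
        ¬×xy : ¬ CrossingPair xy
        ¬×xy = ¬crossing-sameColour xy (∈-pairOfˡ x≢y) (∈-pairOfʳ x≢y) x≢y fx≡fy
        z∉xy : ¬ z ∈ₚ xy
        z∉xy = ∉-pairOf x≢y (x≢z ∘ sym) (y≢z ∘ sym)
        x≁z : ¬ E (vertex x) (vertex z)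
        x≁z = absent (¬H-crossing x×z)
        y≁z : ¬ E (vertex y) (vertex z)
        y≁z = absent (¬H-crossing y×z)
        y≁xz : ¬ E (vertex y) (pair xz)
        y≁xz = absent (¬H-apart xz (∈-pairOfˡ x≢z) (∈-pairOfʳ x≢z) x≢z (Crossing⇒≢sep y×z)
                                   (above⇒apart x<y) (crossing⇒apart y×z))
        x–xy = member-edge xy (∈-pairOfˡ x≢y)
        xy–y = member-edge′ xy (∈-pairOfʳ x≢y)
        y–p  = member-edge p y∈p
        p–z  = member-edge′ p z∈p
        z–xz = member-edge xz (∈-pairOfʳ x≢z)
        xz–x = member-edge′ xz (∈-pairOfˡ x≢z)

      below-member : ∀ {x y z} p → y ∈ₚ p → z ∈ₚ p → Crossing (f y) (f z) → x ≼ y → ¬ ¬ E (vertex x) (pair p)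
      below-member {x} {y} p y∈p z∈p y×z (fx≡fy , x≤y) with x Fin.≟ y
      ... | yes refl = λ ¬x–p → ¬x–p (member-edge p y∈p)
      ... | no  x≢y  = strictlyBelow-member p y∈p z∈p fx≡fy (Fin.≤∧≢⇒< x≤y x≢y) y×z

      vertex-pair : ∀ {x} p → Joined x p → ¬ ¬ E (vertex x) (pair p)
      vertex-pair p (inj₁ x∈p)                     ¬x–p = ¬x–p (member-edge p x∈p)
      vertex-pair p (inj₂ (×p , inj₁ x-sep))         = sep-crossing p x-sep ×p
      vertex-pair p (inj₂ (×p , inj₂ (inj₁ x≼lo)))  = below-member p (inj₁ refl) (inj₂ refl) ×p x≼lo
      vertex-pair p (inj₂ (×p , inj₂ (inj₂ x≼hi)))  = below-member p (inj₂ refl) (inj₁ refl) (Crossing-sym ×p) x≼hi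

      sameColour : ∀ {x x'} → ¬ Sep x → f x ≡ f x' → x Fin.< x' → ¬ ¬ E (vertex x) (vertex x')
      sameColour {x} {x'} x-col fx≡fx' x<x' ¬x–x' =
        vertex-pair x'y (inj₂ (×x'y , fill-member x'y (∈-pairOfˡ x'≢y) (fx≡fx' , ℕ.<⇒≤ x<x'))) λ x–x'y →
        cycle₄ (member-edge xx' (∈-pairOfˡ x≢x')) (member-edge′ xx' (∈-pairOfʳ x≢x'))
               (member-edge x'y (∈-pairOfˡ x'≢y)) (E-sym x–x'y)
               (vertex≢ x≢x') (pair≢ ×x'y ¬×xx' ∘ sym) ¬x–x' (absent (¬H-pairˡ ¬×xx'))
        where
        y = proj₁ (otherColour (x-col ∘ trans fx≡fx'))
        x'×y : Crossing (f x') (f y)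
        x'×y = proj₂ (otherColour (x-col ∘ trans fx≡fx'))
        x≢x' = Fin.<⇒≢ x<x'
        x'≢y = crossing⇒≢ x'×y
        xx' = pairOf x x' x≢x'
        x'y = pairOf x' y x'≢y
        ×x'y : CrossingPair x'y
        ×x'y = crossingPair-intro x'y (∈-pairOfˡ x'≢y) (∈-pairOfʳ x'≢y) x'×y
        ¬×xx' : ¬ CrossingPair xx'
        ¬×xx' = ¬crossing-sameColour xx' (∈-pairOfˡ x≢x') (∈-pairOfʳ x≢x') x≢x' fx≡fx'

      vertex-vertex : ∀ {x y} → H (vertex x) (vertex y) → ¬ ¬ E (vertex x) (vertex y)
      vertex-vertex {x} {y} (x≢y , x≁y) with sep? (f x) | sep? (f y)
      ... | yes x-sep | yes y-sep = sep-sep x-sep y-sep x≢y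
      ... | yes x-sep | no  y-col = sep-coloured y _ x-sep (proj₂ (otherColour y-col))
      ... | no  x-col | yes y-sep = flip¬¬ (sep-coloured x _ y-sep (proj₂ (otherColour x-col)))
      ... | no  x-col | no  y-col with Fin.<-cmp x y
      ...   | tri< x<y _ _ = sameColour x-col (¬Crossing⇒≡ x-col y-col x≁y) x<y
      ...   | tri≈ _ x≡y _ = ⊥-elim (x≢y x≡y)
      ...   | tri> _ _ y<x = flip¬¬ (sameColour y-col (sym (¬Crossing⇒≡ x-col y-col x≁y)) y<x)

      pair-pair-sameColours : ∀ {a b a' b'} p q → a ∈ₚ p → b ∈ₚ p → a' ∈ₚ q → b' ∈ₚ q
        → f a ≡ f a' → f b ≡ f b' → Crossing (f a) (f b) → p ≢ q → ¬ ¬ E (pair p) (pair q)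
      pair-pair-sameColours p q a∈p b∈p a'∈q b'∈q fa≡fa' fb≡fb' a×b p≢q ¬p–q
        with common≼ fa≡fa' | common≼ fb≡fb'
      ... | w₁ , w₁≼a , w₁≼a' | w₂ , w₂≼b , w₂≼b' =
        vertex-pair p (inj₂ (×p , fill-member p a∈p w₁≼a)) λ w₁–p →
        vertex-pair q (inj₂ (×q , fill-member q a'∈q w₁≼a')) λ w₁–q →
        vertex-pair p (inj₂ (×p , fill-member p b∈p w₂≼b)) λ w₂–p →
        vertex-pair q (inj₂ (×q , fill-member q b'∈q w₂≼b')) λ w₂–q →
        cycle₄ (E-sym w₁–p) w₁–q (E-sym w₂–q) w₂–p
               (λ { refl → p≢q refl }) (vertex≢ (crossing⇒≢ w₁×w₂)) ¬p–q (absent (¬H-crossing w₁×w₂))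
        where
        ×p = crossingPair-intro p a∈p b∈p a×b
        ×q = crossingPair-intro q a'∈q b'∈q (subst₂ Crossing fa≡fa' fb≡fb' a×b)
        w₁×w₂ = subst₂ Crossing (sym (proj₁ w₁≼a)) (sym (proj₁ w₂≼b)) a×b

      pair-pair-oneColour : ∀ {a b a' b'} p q → a ∈ₚ p → b ∈ₚ p → a' ∈ₚ q → b' ∈ₚ q
        → f a ≡ f a' → Crossing (f a) (f b) → Crossing (f a) (f b') → Crossing (f b) (f b') → p ≢ q
        → ¬ ¬ E (pair p) (pair q)
      pair-pair-oneColour {a} {b} {a'} {b'} p q a∈p b∈p a'∈q b'∈q fa≡fa' a×b a×b' b×b' p≢q ¬p–q
        with common≼ fa≡fa'
      ... | w , w≼a , w≼a' =
        vertex-pair p (inj₂ (×p , fill-member p a∈p w≼a)) λ w–p →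
        vertex-pair q (inj₂ (×q , fill-member q a'∈q w≼a')) λ w–q →
        ¬¬-excluded-middle {A = E (pair p) (pair bb')} λ
          { (yes p–bb') → ¬¬-excluded-middle {A = E (pair bb') (pair q)} λ
              { (yes bb'–q) → cycle₄ p–bb' bb'–q (E-sym w–q) w–p
                                (λ { refl → p≢q refl }) (λ ()) ¬p–q bb'≁w
              ; (no bb'≁q) → cycle₅ p–bb' bb'–b' b'–q (E-sym w–q) w–p
                               p≁b' ¬p–q bb'≁q bb'≁w b'≁w }
          ; (no p≁bb') → ¬¬-excluded-middle {A = E (pair bb') (pair q)} λ
              { (yes bb'–q) → cycle₅ p–b b–bb' bb'–q (E-sym w–q) w–p
                                p≁bb' ¬p–q b≁q b≁w bb'≁w
              ; (no bb'≁q) → cycle₆ p–b b–bb' bb'–b' b'–q (E-sym w–q) w–p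
                               p≁bb' p≁b' ¬p–q b≁b' b≁q b≁w bb'≁q bb'≁w b'≁w } }
        where
        a'×b' : Crossing (f a') (f b')
        a'×b' = subst (λ l → Crossing l (f b')) fa≡fa' a×b'
        w×b : Crossing (f w) (f b)
        w×b = subst (λ l → Crossing l (f b)) (sym (proj₁ w≼a)) a×b
        w×b' : Crossing (f w) (f b')
        w×b' = subst (λ l → Crossing l (f b')) (sym (proj₁ w≼a)) a×b'
        a≢b = crossing⇒≢ a×b
        a'≢b' = crossing⇒≢ a'×b'
        b≢b' = crossing⇒≢ b×b'
        ×p = crossingPair-intro p a∈p b∈p a×b
        ×q = crossingPair-intro q a'∈q b'∈q a'×b'
        bb' = pairOf b b' b≢b'
        p–b   = member-edge′ p b∈p
        b–bb' = member-edge bb' (∈-pairOfˡ b≢b')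
        bb'–b' = member-edge′ bb' (∈-pairOfʳ b≢b')
        b'–q  = member-edge q b'∈q
        bb'≁w : ¬ E (pair bb') (vertex w)
        bb'≁w = absent (¬H-apart bb' (∈-pairOfˡ b≢b') (∈-pairOfʳ b≢b') b≢b' (Crossing⇒≢sep w×b)
                                 (crossing⇒apart w×b) (crossing⇒apart w×b'))
        p≁b' : ¬ E (pair p) (vertex b')
        p≁b' = absent (¬H-apart p a∈p b∈p a≢b (Crossing⇒≢sep (Crossing-sym b×b'))
                                (crossing⇒apart (Crossing-sym a×b')) (crossing⇒apart (Crossing-sym b×b')))
        b≁q : ¬ E (vertex b) (pair q)
        b≁q = absent (¬H-apart q a'∈q b'∈q a'≢b' (Crossing⇒≢sep b×b')
                               (crossing⇒apart (subst (Crossing (f b)) fa≡fa' (Crossing-sym a×b)))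
                               (crossing⇒apart b×b'))
        b≁w : ¬ E (vertex b) (vertex w)
        b≁w = absent (¬H-crossing (Crossing-sym w×b))
        b'≁w : ¬ E (vertex b') (vertex w)
        b'≁w = absent (¬H-crossing (Crossing-sym w×b'))
        b≁b' : ¬ E (vertex b) (vertex b')
        b≁b' = absent (¬H-crossing b×b')

      pair-pair-sharing : ∀ {a b a' b'} p q → a ∈ₚ p → b ∈ₚ p → a' ∈ₚ q → b' ∈ₚ q
        → f a ≡ f a' → Crossing (f a) (f b) → Crossing (f a') (f b') → p ≢ q → ¬ ¬ E (pair p) (pair q)
      pair-pair-sharing {a} {b} {a'} {b'} p q a∈p b∈p a'∈q b'∈q fa≡fa' a×b a'×b' p≢q
        with crossing? (f b) (f b')
      ... | yes b×b' = pair-pair-oneColour p q a∈p b∈p a'∈q b'∈q fa≡fa' a×b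
                         (subst (λ l → Crossing l (f b')) (sym fa≡fa') a'×b') b×b' p≢q
      ... | no  b≁b' = pair-pair-sameColours p q a∈p b∈p a'∈q b'∈q fa≡fa'
                         (¬Crossing⇒≡ (Crossing⇒≢sep (Crossing-sym a×b))
                                      (Crossing⇒≢sep (Crossing-sym a'×b')) b≁b')
                         a×b p≢q

      pair-pair : ∀ p q → H (pair p) (pair q) → ¬ ¬ E (pair p) (pair q)
      pair-pair p q (p≢q , ×p , ×q) with sharedLabel ×p ×q
      ... | inj₁ (inj₁ lo≡lo) =
        pair-pair-sharing p q (inj₁ refl) (inj₂ refl) (inj₁ refl) (inj₂ refl) lo≡lo ×p ×q p≢q
      ... | inj₁ (inj₂ lo≡hi) =
        pair-pair-sharing p q (inj₁ refl) (inj₂ refl) (inj₂ refl) (inj₁ refl) lo≡hi ×p (Crossing-sym ×q) p≢q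
      ... | inj₂ (inj₁ hi≡lo) =
        pair-pair-sharing p q (inj₂ refl) (inj₁ refl) (inj₁ refl) (inj₂ refl) hi≡lo (Crossing-sym ×p) ×q p≢q
      ... | inj₂ (inj₂ hi≡hi) =
        pair-pair-sharing p q (inj₂ refl) (inj₁ refl) (inj₂ refl) (inj₁ refl) hi≡hi
                          (Crossing-sym ×p) (Crossing-sym ×q) p≢q

      H⊆E : ∀ u v → H u v → ¬ ¬ E u v
      H⊆E (vertex x) (vertex y) = vertex-vertex
      H⊆E (vertex x) (pair p)   = vertex-pair p
      H⊆E (pair p)   (vertex x) = flip¬¬ ∘ vertex-pair p
      H⊆E (pair p)   (pair q)   = pair-pair p q

    H-minimalTriangulation : IsMinimalTriangulation (Gk k) H
    H-minimalTriangulation =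
      (H-simple , Gk⊆H , H-chordal) ,
      λ { H' (H'-simple , G⊆H' , H'-chordal) (H'⊆H , u , v , u~v , u≁v) →
            Forced.H⊆E H'-simple H'-chordal G⊆H' H'⊆H u v u~v u≁v }

    Ω-pmc : IsPMC (Gk k) Ω
    Ω-pmc = H , H-minimalTriangulation , Ω-maximalClique

-- Counting labellings

label : Fin 4 → Label
label 0F       = sep
label (fsuc c) = col c

labelling : ∀ {n} → (Fin n → Fin 4) → Fin (3 + n) → Label
labelling d 0F                     = col 0F
labelling d 1F                     = col 1F
labelling d 2F                     = col 2F
labelling d (fsuc (fsuc (fsuc i))) = label (d i)

Ωᵈ : ∀ {n} → (Fin n → Fin 4) → VSet (Vk (3 + n))
Ωᵈ d = Construction.Ω (labelling d)

Ωᵈ-pmc : ∀ {n} (d : Fin n → Fin 4) → IsPMC (Gk (3 + n)) (Ωᵈ d)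
Ωᵈ-pmc {n} d = Construction.AllColours.Ω-pmc (labelling d) (Fin._↑ˡ n) λ { 0F → refl ; 1F → refl ; 2F → refl }

readLabel : Bool → Bool → Bool → Fin 4
readLabel true  _     _     = 0F
readLabel false false _     = 1F
readLabel false true  false = 2F
readLabel false true  true  = 3F

-- The label of a free vertex j is read off from j, {0, j} and {1, j}.
module _ {n : ℕ} (i : Fin n) where

  private
    j : Fin (3 + n)
    j = fsuc (fsuc (fsuc i))

    0j 1j : Pair (3 + n)
    0j = (0F , j) , s≤s z≤n
    1j = (1F , j) , s≤s (s≤s z≤n)

  decode : VSet (Vk (3 + n)) → Fin 4
  decode Ω = readLabel (Ω (vertex j)) (Ω (pair 0j)) (Ω (pair 1j))

  decode-cong : ∀ {Ω Ω'} → (∀ v → Ω v ≡ Ω' v) → decode Ω ≡ decode Ω'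
  decode-cong {Ω} {Ω'} Ω≗Ω' =
    trans (cong₂ (λ a b → readLabel a b (Ω (pair 1j))) (Ω≗Ω' (vertex j)) (Ω≗Ω' (pair 0j)))
          (cong (readLabel (Ω' (vertex j)) (Ω' (pair 0j))) (Ω≗Ω' (pair 1j)))

  decode-Ωᵈ : ∀ d → decode (Ωᵈ d) ≡ d i
  decode-Ωᵈ d = readLabel-label (d i)
    where
    readLabel-label : ∀ t → readLabel (does (sep? (label t))) (does (crossing? (col 0F) (label t)))
                                      (does (crossing? (col 1F) (label t))) ≡ t
    readLabel-label 0F = refl
    readLabel-label 1F = refl
    readLabel-label 2F = refl
    readLabel-label 3F = refl

funToFin-cong : ∀ {m n} {g h : Fin m → Fin n} → (∀ i → g i ≡ h i) → Fin.funToFin g ≡ Fin.funToFin h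
funToFin-cong {zero}  _   = refl
funToFin-cong {suc m} g≗h = cong₂ Fin.combine (g≗h fzero) (funToFin-cong (g≗h ∘ fsuc))

digits : ∀ n → Fin (4 ^ n) → Fin n → Fin 4
digits n = Fin.finToFun {4} {n}

Ωᵈ-injective : ∀ n (t t' : Fin (4 ^ n)) → (∀ v → Ωᵈ (digits n t) v ≡ Ωᵈ (digits n t') v) → t ≡ t'
Ωᵈ-injective n t t' Ω≗Ω' = begin
  t                              ≡⟨ Fin.funToFin-finToFin {n} t ⟨
  Fin.funToFin (digits n t)      ≡⟨ funToFin-cong digits≗ ⟩
  Fin.funToFin (digits n t')     ≡⟨ Fin.funToFin-finToFin {n} t' ⟩
  t'                             ∎
  where
  open ≡-Reasoning
  digits≗ : ∀ i → digits n t i ≡ digits n t' i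
  digits≗ i = trans (sym (decode-Ωᵈ i (digits n t))) (trans (decode-cong i Ω≗Ω') (decode-Ωᵈ i (digits n t')))

manyPMCs : ∀ n → AtLeastPMCs (Gk (3 + n)) (4 ^ n)
manyPMCs n =
  map (Ωᵈ ∘ digits n) (allFin (4 ^ n)) ,
  All.map⁺ (All.tabulate⁺ (Ωᵈ-pmc ∘ digits n)) ,
  AllPairs.map⁺ (AllPairs.map (λ {t} {t'} t≢t' → t≢t' ∘ Ωᵈ-injective n t t') (Unique.allFin⁺ (4 ^ n))) ,
  ℕ.≤-reflexive (sym (trans (length-map _ (allFin (4 ^ n))) (length-tabulate id)))

-- Small k

Gk-simple : ∀ k → IsSimpleGraph (Gk k)
Gk-simple k = record { sym = λ {u} {v} → Gk-sym {u} {v} ; irref = λ {u} → Gk-irrefl {u} }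
  where
  Gk-sym : ∀ {u v} → Gk k u v → Gk k v u
  Gk-sym {vertex _} {pair _}   x∈p = x∈p
  Gk-sym {pair _}   {vertex _} x∈p = x∈p

  Gk-irrefl : ∀ {u} → ¬ Gk k u u
  Gk-irrefl {vertex _} ()
  Gk-irrefl {pair _}   ()

chordal⇒minimalTriangulation : ∀ {V} {G : Rel V} → IsSimpleGraph G → Chordal G → IsMinimalTriangulation G G
chordal⇒minimalTriangulation G-simple G-chordal =
  (G-simple , (λ _ _ e → e) , G-chordal) ,
  λ { H' (_ , G⊆H' , _) (_ , u , v , u–v , u≁v) → u≁v (G⊆H' u v u–v) }

-- Eliminate [k] first: each of its vertices has at most one pair as neighbour.
atMostOnePair⇒chordal : ∀ {k} → (∀ (p q : Pair k) → p ≡ q) → Chordal (Gk k)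
atMostOnePair⇒chordal {k} pairs-equal =
  perfectEliminationRank⇒chordal (IsSimpleGraph.sym (Gk-simple k)) peo
  where
  rank : Vk k → ℕ
  rank (vertex _) = 0
  rank (pair _)   = 1

  peo : PerfectEliminationRank (Gk k) rank
  peo {vertex _} {pair p} {pair q} _ _ _ _ p≢q = ⊥-elim (p≢q (cong pair (pairs-equal p q)))
  peo {pair _}   {vertex _}        _ _ ()

noPair₁ : ¬ Pair 1
noPair₁ ((0F , 0F) , ())

pmc₁ : IsPMC (Gk 1) (λ _ → true)
pmc₁ = Gk 1 , chordal⇒minimalTriangulation (Gk-simple 1) (atMostOnePair⇒chordal (⊥-elim ∘ noPair₁)) ,
       clique , λ _ _ _ _ _ → refl
  where
  clique : IsClique (Gk 1) (λ _ → true)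
  clique (vertex 0F) (vertex 0F) _ _ u≢v = ⊥-elim (u≢v refl)
  clique (pair p)    _           _ _ _   = ⊥-elim (noPair₁ p)
  clique _           (pair q)    _ _ _   = ⊥-elim (noPair₁ q)

pair₂-unique : (p q : Pair 2) → p ≡ q
pair₂-unique ((0F , 1F) , s≤s z≤n) ((0F , 1F) , s≤s z≤n) = refl
pair₂-unique ((0F , 0F) , ())     _
pair₂-unique ((1F , 0F) , ())     _
pair₂-unique ((1F , 1F) , s≤s ()) _
pair₂-unique _                    ((0F , 0F) , ())
pair₂-unique _                    ((1F , 0F) , ())
pair₂-unique _                    ((1F , 1F) , s≤s ())

Ω₂ : VSet (Vk 2)
Ω₂ (vertex 0F) = true
Ω₂ (vertex 1F) = false
Ω₂ (pair _)    = true

pmc₂ : IsPMC (Gk 2) Ω₂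
pmc₂ = Gk 2 , chordal⇒minimalTriangulation (Gk-simple 2) (atMostOnePair⇒chordal pair₂-unique) ,
       clique , maximal
  where
  0∈p : (p : Pair 2) → 0F ∈ₚ p
  0∈p p rewrite pair₂-unique p ((0F , 1F) , s≤s z≤n) = inj₁ refl

  clique : IsClique (Gk 2) Ω₂
  clique (vertex 0F) (vertex 0F) _  _  u≢v = ⊥-elim (u≢v refl)
  clique (vertex 0F) (pair p)    _  _  _   = 0∈p p
  clique (pair p)    (vertex 0F) _  _  _   = 0∈p p
  clique (pair p)    (pair q)    _  _  u≢v = ⊥-elim (u≢v (cong pair (pair₂-unique p q)))
  clique (vertex 1F) _           () _  _
  clique _           (vertex 1F) _  () _

  maximal : ∀ Ω' → IsClique (Gk 2) Ω' → Ω₂ ⊆ᵥ Ω' → Ω' ⊆ᵥ Ω₂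
  maximal Ω' clique' Ω₂⊆Ω' (vertex 0F) _   = refl
  maximal Ω' clique' Ω₂⊆Ω' (vertex 1F) ω'₁ = ⊥-elim (clique' (vertex 0F) (vertex 1F) (Ω₂⊆Ω' _ refl) ω'₁ (λ ()))
  maximal Ω' clique' Ω₂⊆Ω' (pair _)    _   = refl

onePMC : ∀ {V} {G : Rel V} {Ω} → IsPMC G Ω → AtLeastPMCs G 1
onePMC {Ω = Ω} pmc = (Ω List.∷ List.[]) , (pmc ∷ []) , ([] AllPairs.∷ AllPairs.[]) , ℕ.≤-refl

theorem12 : ∃[ p ] ∃[ q ] (0 < p × 0 < q
              × (∀ (k : ℕ) → 1 ≤ k → ∃[ N ] (AtLeastPMCs (Gk k) N × p * 4 ^ k ≤ q * N)))
theorem12 = 1 , 64 , s≤s z≤n , s≤s z≤n , count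
  where
  count : ∀ k → 1 ≤ k → ∃[ N ] (AtLeastPMCs (Gk k) N × 1 * 4 ^ k ≤ 64 * N)
  count 1             _ = 1 , onePMC pmc₁ , ℕ.≤ᵇ⇒≤ 4 64 _
  count 2             _ = 1 , onePMC pmc₂ , ℕ.≤ᵇ⇒≤ 16 64 _
  count (suc (suc (suc n))) _ = 4 ^ n , manyPMCs n , ℕ.≤-reflexive 4^[3+n]
    where
    4^[3+n] : 1 * 4 ^ (3 + n) ≡ 64 * 4 ^ n
    4^[3+n] = trans (ℕ.*-identityˡ (4 ^ (3 + n)))
                    (trans (sym (ℕ.*-assoc 4 4 (4 * 4 ^ n))) (sym (ℕ.*-assoc 16 4 (4 ^ n))))
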